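{- Let $\langle \pi, \equiv_\pi \rangle$ be an abstract semantics that is fair and strong smn. Then for every total computable function $h:\mathbb{N}\to\mathbb{N}$ and every arity $n\geq 1$ there exists an index $a\in\mathbb{N}$ such that $a \sim_\pi^n h(a)$, i.e. $\pi_a^{(n)} \equiv_\pi \pi_{h(a)}^{(n)}$.
   Context: Fix a Turing-complete programming model with a Gödel numbering of its programs; for $a,n\in\mathbb{N}$, $\phi_a^{(n)}:\mathbb{N}^n\rightharpoonup\mathbb{N}$ denotes the $n$-ary partial function computed by the $a$-th program, and every $n$-ary partial recursive function equals $\phi_a^{(n)}$ for some $a$ (write $\phi_a=\phi_a^{(1)}$). Let $\mathcal{F}$ denote the class of all partial functions $\mathbb{N}^n\rightharpoonup\mathbb{N}$, $n\in\mathbb{N}$. An abstract semantics is a pair $\langle\pi,\equiv_\pi\rangle$ where $\pi$ assigns to each index $a$ and arity $n$ a (not necessarily computable) partial function $\pi_a^{(n)}:\mathbb{N}^n\rightharpoonup\mathbb{N}$, and $\equiv_\pi$ is an equivalence relation on $\mathcal{F}$. The induced program equivalence is $a\sim_\pi^n b$ iff $\pi_a^{(n)}\equiv_\pi\pi_b^{(n)}$. The abstract semantics is strong smn if for all $m,n\ge 1$ there is a total computable $s:\mathbb{N}^{m+2}\to\mathbb{N}$ such that for all $a,b\in\mathbb{N}$ and $\vec x\in\mathbb{N}^m$: $\lambda\vec y.\,\pi_a^{(n+1)}(\phi_b^{(m)}(\vec x),\vec y)\equiv_\pi \pi_{s(a,b,\vec x)}^{(n)}$ (the left side is everywhere undefined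 if $\phi_b^{(m)}(\vec x)$ is undefined). It is fair if for every arity $n$ there is $u\in\mathbb{N}$ such that for all $a\in\mathbb{N}$: $\pi_a^{(n)}\equiv_\pi \lambda\vec y.\,\pi_u^{(n+1)}(a,\vec y)$. -}

module Defs where

open import Data.Nat using (ℕ; zero; suc; _+_; _<_; _≥_)
open import Data.Fin using (Fin)
open import Data.Vec using (Vec; []; _∷_; lookup; _++_; [_])
open import Data.Product using (Σ; _×_; _,_; ∃; proj₁; proj₂)
open import Relation.Binary.PropositionalEquality using (_≡_; refl; cong)
open import Relation.Binary.Structures using (IsEquivalence)
open import Function.Bundles using (_⇔_)

data PR : ℕ → Set where
  Z    : ∀ {n} → PR n
  S    : PR 1
  P    : ∀ {n} → Fin n → PR n
  C    : ∀ {m n} → PR m → Vec (PR n) m → PR n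
  R    : ∀ {n} → PR n → PR (suc (suc n)) → PR (suc n)
  M    : ∀ {n} → PR (suc n) → PR n

mutual
  data Eval : ∀ {n} → PR n → Vec ℕ n → ℕ → Set where
    eZ : ∀ {n} {x : Vec ℕ n} → Eval Z x 0
    eS : ∀ {k} → Eval S (k ∷ []) (suc k)
    eP : ∀ {n} {i : Fin n} {x : Vec ℕ n} → Eval (P i) x (lookup x i)
    eC : ∀ {m n} {f : PR m} {gs : Vec (PR n) m} {x : Vec ℕ n} {ys : Vec ℕ m} {z : ℕ} →
         EvalAll gs x ys → Eval f ys z → Eval (C f gs) x z
    eR0 : ∀ {n} {f : PR n} {g : PR (suc (suc n))} {x : Vec ℕ n} {y : ℕ} →
          Eval f x y → Eval (R f g) (0 ∷ x) y
    eRS : ∀ {n} {f : PR n} {g : PR (suc (suc n))} {x : Vec ℕ n} {k r z : ℕ} →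
          Eval (R f g) (k ∷ x) r → Eval g (k ∷ r ∷ x) z → Eval (R f g) (suc k ∷ x) z
    eM : ∀ {n} {f : PR (suc n)} {x : Vec ℕ n} {y : ℕ} →
         Eval f (y ∷ x) 0 →
         (∀ i → i < y → Σ ℕ λ k → Eval f (i ∷ x) (suc k)) →
         Eval (M f) x y

  data EvalAll : ∀ {m n} → Vec (PR n) m → Vec ℕ n → Vec ℕ m → Set where
    [] : ∀ {n} {x : Vec ℕ n} → EvalAll [] x []
    _∷_ : ∀ {m n} {g : PR n} {gs : Vec (PR n) m} {x : Vec ℕ n} {y : ℕ} {ys : Vec ℕ m} →
          Eval g x y → EvalAll gs x ys → EvalAll (g ∷ gs) x (y ∷ ys)

record PartialFn (n : ℕ) : Set₁ where
  field
    graph      : Vec ℕ n → ℕ → Set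
    functional : ∀ {x y z} → graph x y → graph x z → y ≡ z
open PartialFn public

𝓕 : Set₁
𝓕 = Σ ℕ PartialFn

ComputedBy : ∀ {n} → PR n → PartialFn n → Set
ComputedBy t f = ∀ x y → Eval t x y ⇔ graph f x y

TotalComputable : ∀ n → (Vec ℕ n → ℕ) → Set
TotalComputable n f = Σ (PR n) λ t → ∀ x y → Eval t x y ⇔ (f x ≡ y)

-- A Turing-complete programming model with a Gödel numbering
-- (an acceptable programming system): φ a n is φ_a^(n).

record ProgrammingModel : Set₁ where
  field
    φ : ℕ → (n : ℕ) → PartialFn n
    complete  : ∀ n (t : PR n) → Σ ℕ λ a → ComputedBy t (φ a n)
    universal : ∀ n → Σ (PR (suc n)) λ t →
                  ∀ a x y → Eval t (a ∷ x) y ⇔ graph (φ a n) x y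
    smn       : ∀ m n → Σ (Vec ℕ (suc m) → ℕ) λ s → TotalComputable (suc m) s ×
                  (∀ a (x : Vec ℕ m) (y : Vec ℕ n) z →
                     graph (φ (s (a ∷ x)) n) y z ⇔ graph (φ a (m + n)) (x ++ y) z)

fixFirst : ∀ {n} → ℕ → PartialFn (suc n) → PartialFn n
graph      (fixFirst k f) y z = graph f (k ∷ y) z
functional (fixFirst k f) p q = functional f p q

-- λ y⃗. f(g(x⃗), y⃗)  (undefined everywhere if g(x⃗) is undefined)
plugFirst : ∀ {m n} → PartialFn (suc n) → PartialFn m → Vec ℕ m → PartialFn n
graph      (plugFirst f g x) y z = Σ ℕ λ k → graph g x k × graph f (k ∷ y) z
functional (plugFirst f g x) (k , gk , fz) (k' , gk' , fz') with functional g gk gk'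
... | refl = functional f fz fz'

record AbstractSemantics : Set₂ where
  field
    π      : ℕ → (n : ℕ) → PartialFn n
    _≡π_   : 𝓕 → 𝓕 → Set₁
    isEquivalence : IsEquivalence _≡π_
    -- ≡π is a relation on partial functions as mathematical objects, so
    -- partial functions with the same graph are identified (reflexivity)
    respectsGraph : ∀ {n} (f g : PartialFn n) →
                    (∀ x y → graph f x y ⇔ graph g x y) → (n , f) ≡π (n , g)

module _ (M : ProgrammingModel) (A : AbstractSemantics) where
  open ProgrammingModel M
  open AbstractSemantics A

  _∼π[_]_ : ℕ → ℕ → ℕ → Set₁
  a ∼π[ n ] b = (n , π a n) ≡π (n , π b n)

  StrongSmn : Set₁
  StrongSmn = ∀ m n → m ≥ 1 → n ≥ 1 →
    Σ (Vec ℕ (suc (suc m)) → ℕ) λ s → TotalComputable (suc (suc m)) s ×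
      (∀ a b (x : Vec ℕ m) →
         (n , plugFirst (π a (suc n)) (φ b m) x) ≡π (n , π (s (a ∷ b ∷ x)) n))

  Fair : Set₁
  Fair = ∀ n → Σ ℕ λ u → ∀ a → (n , π a n) ≡π (n , fixFirst a (π u (suc n)))

-- Kleene's diagonal argument, carried out in the abstract semantics. Let u be the fair
-- universal index for arity n and s the strong smn function with m = 1. Take a program e
-- computing x ↦ h (s (u, x, x)) and put a = s (u, e, e). Then
--   π_a ≡π λy. π_u(φ_e(e), y) = λy. π_u(h a, y) ≡π π_{h a}
-- by strong smn, the choice of e, and fairness.
module Submission where

open import Defs
open import Data.Nat using (ℕ; zero; suc; _≥_; s≤s; z≤n)
open import Data.Fin using () renaming (zero to fzero)
open import Data.Vec using (Vec; head; []; _∷_; [_])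
open import Data.Product using (Σ; _,_; proj₁)
open import Relation.Binary.PropositionalEquality using (refl; subst)
open import Relation.Binary.Structures using (IsEquivalence)
open import Function.Bundles using (Equivalence; mk⇔)

const : ℕ → PR 1
const zero    = Z
const (suc k) = C S [ const k ]

eval-const : ∀ k x → Eval (const k) [ x ] k
eval-const zero    x = eZ
eval-const (suc k) x = eC (eval-const k x ∷ []) eS

eval-total : ∀ {n} {f : Vec ℕ n → ℕ} ((t , spec) : TotalComputable n f) x →
             Eval t x (f x)
eval-total (t , spec) x = Equivalence.from (spec x _) refl

diagonal : (h : ℕ → ℕ) → TotalComputable 1 (λ v → h (head v)) →
           (s : Vec ℕ 3 → ℕ) → TotalComputable 3 s → (u : ℕ) →
           Σ (PR 1) λ t → ∀ x → Eval t [ x ] (h (s (u ∷ x ∷ x ∷ [])))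
diagonal h h-comp s s-comp u =
    C (proj₁ h-comp) [ C (proj₁ s-comp) (const u ∷ P fzero ∷ P fzero ∷ []) ]
  , λ x → eC (eC (eval-const u x ∷ eP ∷ eP ∷ []) (eval-total s-comp _) ∷ [])
             (eval-total h-comp _)

module _ (A : AbstractSemantics) where
  open AbstractSemantics A

  plugFirst-defined : ∀ {m n} (f : PartialFn (suc n)) (g : PartialFn m) {x k} →
                      graph g x k → (n , plugFirst f g x) ≡π (n , fixFirst k f)
  plugFirst-defined f g gx≡k = respectsGraph _ _ λ y z → mk⇔
    (λ (k′ , gx≡k′ , fk′y≡z) →
       subst (λ j → graph f (j ∷ y) z) (functional g gx≡k′ gx≡k) fk′y≡z)
    (λ fky≡z → _ , gx≡k , fky≡z)

mainTheorem1 : (M : ProgrammingModel) (A : AbstractSemantics) →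
    Fair M A → StrongSmn M A →
    (h : ℕ → ℕ) → TotalComputable 1 (λ v → h (head v)) →
    ∀ n → n ≥ 1 → Σ ℕ λ a → _∼π[_]_ M A a n (h a)
mainTheorem1 model A fair strongSmn h h-comp n n≥1
  with fair n | strongSmn 1 n (s≤s z≤n) n≥1
... | u , fair-u | s , s-comp , smn-eq
  with diagonal h h-comp s s-comp u
... | t , eval-t
  with ProgrammingModel.complete model 1 t
... | e , e-computes-t = a , a∼ha
  where
  open ProgrammingModel model
  open AbstractSemantics A
  open IsEquivalence isEquivalence renaming (sym to ≡π-sym; trans to ≡π-trans)

  a : ℕ
  a = s (u ∷ e ∷ e ∷ [])

  φe[e]≡ha : graph (φ e 1) [ e ] (h a)
  φe[e]≡ha = Equivalence.to (e-computes-t _ _) (eval-t e)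

  a∼ha : (n , π a n) ≡π (n , π (h a) n)
  a∼ha = ≡π-trans (≡π-sym (smn-eq u e [ e ]))
        (≡π-trans (plugFirst-defined A (π u (suc n)) (φ e 1) φe[e]≡ha)
                  (≡π-sym (fair-u (h a))))
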